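{- Let $\mathcal{M}$ be a non-orientable regular map of type $\{p,q\}$ where one of $p$ or $q$ is odd, and let $\vartheta\colon E(\mathcal{M})\to\mathbb{Z}_4$ assign $0$ to every edge of colour $1$ and $1$ to every other edge. Then $\mathcal{M}$ contains a closed walk of odd length whose $\vartheta$-weight is even.
   Context: A $3$-maniplex is a connected $3$-valent simple graph with a proper edge-colouring by $\{0,1,2\}$ such that the edges of colours $0$ and $2$ form a disjoint union of $4$-cycles; vertices are flags. A regular map is a $3$-maniplex whose colour-preserving automorphism group is transitive on flags; non-orientable means not bipartite; type $\{p,q\}$ means the components of the subgraph of colours $0,1$ are cycles of length $2p$ and those of colours $1,2$ are cycles of length $2q$. For a walk $W=(u_0,\dots,u_m)$ with edges $e_j=u_ju_{j+1}$, its weight is $\vartheta(W)=\sum_{j=0}^{m-1}(-1)^j\vartheta(e_j)\in\mathbb{Z}_4$; it is even if it lies in $\{0,2\}$. -}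

module Defs where

open import Data.Nat using (ℕ; zero; suc; _*_; _<_; _%_)
open import Data.Fin using (Fin; zero; suc)
open import Data.List using (List; []; _∷_; length)
open import Data.Integer using (ℤ; +_; _-_; _%ℕ_)
open import Data.Bool using (Bool)
open import Data.Product using (Σ; ∃; _×_; _,_)
open import Data.Sum using (_⊎_)
open import Relation.Binary.PropositionalEquality using (_≡_; _≢_)
open import Relation.Nullary using (¬_)

Colour : Set
Colour = Fin 3

c0 c1 c2 : Colour
c0 = zero
c1 = suc zero
c2 = suc (suc zero)

-- A 3-valent simple graph with a proper 3-edge-colouring on vertex set Fin n
-- is encoded by r i x = the unique neighbour of x along the edge of colour i.
-- A walk is a start vertex together with the list of colours of its edges
-- (in a simple properly coloured graph this determines the walk).
walkEnd : ∀ {n} → (Colour → Fin n → Fin n) → Fin n → List Colour → Fin n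
walkEnd r x []       = x
walkEnd r x (c ∷ cs) = walkEnd r (r c x) cs

iter : ∀ {n} → ℕ → (Fin n → Fin n) → Fin n → Fin n
iter zero    f x = x
iter (suc k) f x = f (iter k f x)

IsOrbitLength : ∀ {n} → (Fin n → Fin n) → Fin n → ℕ → Set
IsOrbitLength f x m =
  0 < m × iter m f x ≡ x × (∀ k → 0 < k → k < m → iter k f x ≢ x)

record Maniplex3 (n : ℕ) : Set where
  field
    r          : Colour → Fin n → Fin n
    involution : ∀ i x → r i (r i x) ≡ x
    noLoop     : ∀ i x → r i x ≢ x
    simple     : ∀ i j x → i ≢ j → r i x ≢ r j x
    square02   : ∀ x → r c0 (r c2 (r c0 (r c2 x))) ≡ x
    connected  : ∀ x y → ∃ λ (cs : List Colour) → walkEnd r x cs ≡ y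

open Maniplex3 public

ComponentCycleLength : ∀ {n} → Maniplex3 n → Colour → Colour → Fin n → ℕ → Set
ComponentCycleLength M i j x ℓ =
  ∃ λ m → IsOrbitLength (λ y → r M j (r M i y)) x m × ℓ ≡ 2 * m

HasType : ∀ {n} → Maniplex3 n → ℕ → ℕ → Set
HasType M p q = ∀ x → ComponentCycleLength M c0 c1 x (2 * p)
                    × ComponentCycleLength M c1 c2 x (2 * q)

record Automorphism {n} (M : Maniplex3 n) : Set where
  field
    f     : Fin n → Fin n
    g     : Fin n → Fin n
    gf    : ∀ x → g (f x) ≡ x
    fg    : ∀ x → f (g x) ≡ x
    preserves : ∀ i x → f (r M i x) ≡ r M i (f x)

RegularMap : ∀ {n} → Maniplex3 n → Set
RegularMap M = ∀ x y → ∃ λ (φ : Automorphism M) → Automorphism.f φ x ≡ y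

Bipartite : ∀ {n} → Maniplex3 n → Set
Bipartite {n} M = ∃ λ (col : Fin n → Bool) → ∀ i x → col (r M i x) ≢ col x

NonOrientable : ∀ {n} → Maniplex3 n → Set
NonOrientable M = ¬ Bipartite M

θ : Colour → ℤ
θ zero             = + 1
θ (suc zero)       = + 0
θ (suc (suc zero)) = + 1

-- alternating weight  Σ_j (-1)^j θ(e_j), computed in ℤ (reduced mod 4 below)
weight : List Colour → ℤ
weight []       = + 0
weight (c ∷ cs) = θ c - weight cs

EvenWeight : List Colour → Set
EvenWeight cs = (weight cs %ℕ 4 ≡ 0) ⊎ (weight cs %ℕ 4 ≡ 2)

Odd : ℕ → Set
Odd k = k % 2 ≡ 1

{-# OPTIONS --safe #-}
-- A non-bipartite connected graph has a closed walk of odd length: colour each flag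
-- by the parity of the length of a fixed walk to it from a base flag; this colouring
-- is not proper, and a monochromatic edge closes an odd walk W. Modulo 2 the signs
-- in the weight do not matter, so the weight of a walk is congruent to its number
-- of edges of colour 0 or 2 (its unsigned weight). If that number is odd for W,
-- append at the base flag the boundary walk (0 1)^p of its face, or (1 2)^q around
-- its vertex: it has even length and p (resp. q) edges of colour 0 or 2, so the
-- result has odd length and even weight.
module Submission where

open import Defs
open import Data.Nat using (ℕ)
open import Data.Fin using (Fin)
open import Data.List using (List; length)
open import Data.Product using (∃; _×_)
open import Data.Sum using (_⊎_)
open import Relation.Binary.PropositionalEquality using (_≡_)

open import Data.Bool using (Bool; true; false)
open import Data.Empty using (⊥-elim)
import Data.Fin as F
open import Data.Fin.Properties using (any?)
open import Data.Integer as ℤ using (+_; ∣_∣; _%ℕ_; _/ℕ_; -_; _-_)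
open import Data.Integer.DivMod using (n%ℕd<d; a≡a%ℕn+[a/ℕn]*n)
open import Data.Integer.Divisibility.Signed as ℤ∣
  using (divides; ∣⇒∣ᵤ; ∣ᵤ⇒∣; ∣m⇒∣-m; ∣m∣n⇒∣m+n; ∣m+n∣n⇒∣m; ∣n⇒∣m*n)
open import Data.Integer.Tactic.RingSolver using (solve-∀)
open import Data.List using ([]; _∷_; _++_; reverse; _∷ʳ_; map)
open import Data.List.Properties using (length-++; length-reverse; unfold-reverse; map-++)
open import Data.Nat.ListAction using (sum)
open import Data.Nat.ListAction.Properties using (sum-++)
open import Data.Nat as ℕ using (zero; suc; _<_; s≤s; _*_; _%_; parity)
open import Data.Nat.Divisibility as ℕ∣ using (_∣0; n∣m⇒m%n≡0)
open import Data.Nat.Properties using (+-assoc; *-identityʳ; *-cancelˡ-≡)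
open import Data.Parity as ℙ using (Parity; 0ℙ; 1ℙ; _⁻¹)
open import Data.Parity.Properties using (+-homo-+; p+p⁻¹≡1ℙ)
open import Data.Product using (_,_; proj₁; proj₂)
open import Data.Sum using (inj₁; inj₂)
open import Function using (_∘_)
open import Relation.Binary.PropositionalEquality
  using (_≢_; refl; sym; trans; cong; cong₂; subst; module ≡-Reasoning)
open import Relation.Nullary using (¬_; yes; no)

open ≡-Reasoning

parity≡1ℙ⇒odd : ∀ n → parity n ≡ 1ℙ → Odd n
parity≡1ℙ⇒odd 1             _ = refl
parity≡1ℙ⇒odd (suc (suc n)) e = parity≡1ℙ⇒odd n e

odd⇒parity≡1ℙ : ∀ n → Odd n → parity n ≡ 1ℙ
odd⇒parity≡1ℙ 1             _ = refl
odd⇒parity≡1ℙ (suc (suc n)) o = odd⇒parity≡1ℙ n o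

parity≡0ℙ⇒2∣ : ∀ n → parity n ≡ 0ℙ → 2 ℕ∣.∣ n
parity≡0ℙ⇒2∣ 0             _ = 2 ∣0
parity≡0ℙ⇒2∣ (suc (suc n)) e = ℕ∣.∣m∣n⇒∣m+n ℕ∣.∣-refl (parity≡0ℙ⇒2∣ n e)

r<4⇒r%2≡0⇒r≡0⊎r≡2 : ∀ r → r < 4 → r % 2 ≡ 0 → r ≡ 0 ⊎ r ≡ 2
r<4⇒r%2≡0⇒r≡0⊎r≡2 0 _ _ = inj₁ refl
r<4⇒r%2≡0⇒r≡0⊎r≡2 2 _ _ = inj₂ refl
r<4⇒r%2≡0⇒r≡0⊎r≡2 1 _ ()
r<4⇒r%2≡0⇒r≡0⊎r≡2 3 _ ()
r<4⇒r%2≡0⇒r≡0⊎r≡2 (suc (suc (suc (suc _)))) (s≤s (s≤s (s≤s (s≤s ())))) _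

2∣i⇒i%ℕ4≡0⊎i%ℕ4≡2 : ∀ i → + 2 ℤ∣.∣ i → i %ℕ 4 ≡ 0 ⊎ i %ℕ 4 ≡ 2
2∣i⇒i%ℕ4≡0⊎i%ℕ4≡2 i 2∣i = r<4⇒r%2≡0⇒r≡0⊎r≡2 (i %ℕ 4) (n%ℕd<d i 4) (n∣m⇒m%n≡0 _ 2 (∣⇒∣ᵤ 2∣r))
  where
  2∣r+q*4 : + 2 ℤ∣.∣ + (i %ℕ 4) ℤ.+ (i /ℕ 4) ℤ.* + 4
  2∣r+q*4 = subst (+ 2 ℤ∣.∣_) (a≡a%ℕn+[a/ℕn]*n i 4) 2∣i
  2∣r : + 2 ℤ∣.∣ + (i %ℕ 4)
  2∣r = ∣m+n∣n⇒∣m 2∣r+q*4 (∣n⇒∣m*n (i /ℕ 4) (divides (+ 2) refl))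

unsignedWeight : List Colour → ℕ
unsignedWeight cs = sum (map (∣_∣ ∘ θ) cs)

+∣θ∣≡θ : ∀ c → + ∣ θ c ∣ ≡ θ c
+∣θ∣≡θ F.zero                 = refl
+∣θ∣≡θ (F.suc F.zero)         = refl
+∣θ∣≡θ (F.suc (F.suc F.zero)) = refl

[t-w]-[t+s]≡-[[w-s]+s*2] : ∀ t w s → t - w - (t ℤ.+ s) ≡ - ((w - s) ℤ.+ s ℤ.* + 2)
[t-w]-[t+s]≡-[[w-s]+s*2] = solve-∀

2∣weight-unsignedWeight : ∀ cs → + 2 ℤ∣.∣ weight cs - + unsignedWeight cs
2∣weight-unsignedWeight []       = divides (+ 0) refl
2∣weight-unsignedWeight (c ∷ cs) =
  subst (+ 2 ℤ∣.∣_) (sym weight≡)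
    (∣m⇒∣-m (∣m∣n⇒∣m+n (2∣weight-unsignedWeight cs) (∣n⇒∣m*n s ℤ∣.∣-refl)))
  where
  t = θ c
  w = weight cs
  s = + unsignedWeight cs
  weight≡ : t - w - + (∣ t ∣ ℕ.+ unsignedWeight cs) ≡ - ((w - s) ℤ.+ s ℤ.* + 2)
  weight≡ = begin
    t - w - (+ ∣ t ∣ ℤ.+ s)  ≡⟨ cong (λ u → t - w - (u ℤ.+ s)) (+∣θ∣≡θ c) ⟩
    t - w - (t ℤ.+ s)        ≡⟨ [t-w]-[t+s]≡-[[w-s]+s*2] t w s ⟩
    - ((w - s) ℤ.+ s ℤ.* + 2) ∎

even-unsignedWeight⇒EvenWeight : ∀ cs → parity (unsignedWeight cs) ≡ 0ℙ → EvenWeight cs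
even-unsignedWeight⇒EvenWeight cs even = 2∣i⇒i%ℕ4≡0⊎i%ℕ4≡2 (weight cs) 2∣weight
  where
  2∣weight : + 2 ℤ∣.∣ weight cs
  2∣weight = ∣m+n∣n⇒∣m (2∣weight-unsignedWeight cs)
    (∣m⇒∣-m (∣ᵤ⇒∣ (parity≡0ℙ⇒2∣ (unsignedWeight cs) even)))

unsignedWeight-++ : ∀ xs ys → unsignedWeight (xs ++ ys) ≡ unsignedWeight xs ℕ.+ unsignedWeight ys
unsignedWeight-++ xs ys = trans (cong sum (map-++ (∣_∣ ∘ θ) xs ys)) (sum-++ (map (∣_∣ ∘ θ) xs) _)

parity-++ : ∀ (f : List Colour → ℕ) → (∀ xs ys → f (xs ++ ys) ≡ f xs ℕ.+ f ys) →
  ∀ xs ys → parity (f (xs ++ ys)) ≡ parity (f xs) ℙ.+ parity (f ys)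
parity-++ f f-++ xs ys = trans (cong parity (f-++ xs ys)) (+-homo-+ (f xs) (f ys))

alternating : ℕ → Colour → Colour → List Colour
alternating zero    i j = []
alternating (suc m) i j = i ∷ j ∷ alternating m i j

parity-length-alternating : ∀ m i j → parity (length (alternating m i j)) ≡ 0ℙ
parity-length-alternating zero    i j = refl
parity-length-alternating (suc m) i j = parity-length-alternating m i j

unsignedWeight-alternating : ∀ m i j →
  unsignedWeight (alternating m i j) ≡ m * (∣ θ i ∣ ℕ.+ ∣ θ j ∣)
unsignedWeight-alternating zero    i j = refl
unsignedWeight-alternating (suc m) i j =
  trans (sym (+-assoc ∣ θ i ∣ ∣ θ j ∣ _)) (cong (∣ θ i ∣ ℕ.+ ∣ θ j ∣ ℕ.+_) (unsignedWeight-alternating m i j))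

iter-shift : ∀ {n} m (f : Fin n → Fin n) x → iter m f (f x) ≡ f (iter m f x)
iter-shift zero    f x = refl
iter-shift (suc m) f x = cong f (iter-shift m f x)

ClosedWalk : ∀ {n} → (Colour → Fin n → Fin n) → Fin n → List Colour → Set
ClosedWalk r x cs = walkEnd r x cs ≡ x

module _ {n} (r : Colour → Fin n → Fin n) where

  walkEnd-++ : ∀ x xs ys → walkEnd r x (xs ++ ys) ≡ walkEnd r (walkEnd r x xs) ys
  walkEnd-++ x []       ys = refl
  walkEnd-++ x (c ∷ xs) ys = walkEnd-++ (r c x) xs ys

  closed-++ : ∀ {x xs ys} → ClosedWalk r x xs → ClosedWalk r x ys → ClosedWalk r x (xs ++ ys)
  closed-++ {x} {xs} {ys} xs-closed ys-closed =
    trans (walkEnd-++ x xs ys) (trans (cong (λ y → walkEnd r y ys) xs-closed) ys-closed)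

  walkEnd-reverse : (∀ i x → r i (r i x) ≡ x) → ∀ x cs → walkEnd r (walkEnd r x cs) (reverse cs) ≡ x
  walkEnd-reverse involutive x []       = refl
  walkEnd-reverse involutive x (c ∷ cs) = begin
    walkEnd r (walkEnd r (r c x) cs) (reverse (c ∷ cs)) ≡⟨ cong (walkEnd r _) (unfold-reverse c cs) ⟩
    walkEnd r (walkEnd r (r c x) cs) (reverse cs ∷ʳ c)  ≡⟨ walkEnd-++ _ (reverse cs) (c ∷ []) ⟩
    r c (walkEnd r (walkEnd r (r c x) cs) (reverse cs)) ≡⟨ cong (r c) (walkEnd-reverse involutive (r c x) cs) ⟩
    r c (r c x)                                         ≡⟨ involutive c x ⟩
    x                                                   ∎

  walkEnd-alternating : ∀ m i j x → walkEnd r x (alternating m i j) ≡ iter m (r j ∘ r i) x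
  walkEnd-alternating zero    i j x = refl
  walkEnd-alternating (suc m) i j x =
    trans (walkEnd-alternating m i j (r j (r i x))) (iter-shift m (r j ∘ r i) x)

module _ {n} (M : Maniplex3 (suc n)) where

  private
    pathTo : Fin (suc n) → List Colour
    pathTo y = proj₁ (connected M F.zero y)

    distanceParity : Fin (suc n) → Parity
    distanceParity y = parity (length (pathTo y))

  monochromaticEdge⇒oddClosedWalk : ∀ x i → distanceParity (r M i x) ≡ distanceParity x →
    ∃ λ cs → ClosedWalk (r M) F.zero cs × parity (length cs) ≡ 1ℙ
  monochromaticEdge⇒oddClosedWalk x i same = px ++ i ∷ reverse py , closed , odd
    where
    y  = r M i x
    px = pathTo x
    py = pathTo y
    closed : ClosedWalk (r M) F.zero (px ++ i ∷ reverse py)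
    closed = begin
      walkEnd (r M) F.zero (px ++ i ∷ reverse py)
        ≡⟨ walkEnd-++ (r M) F.zero px (i ∷ reverse py) ⟩
      walkEnd (r M) (r M i (walkEnd (r M) F.zero px)) (reverse py)
        ≡⟨ cong (λ z → walkEnd (r M) (r M i z) (reverse py)) (proj₂ (connected M F.zero x)) ⟩
      walkEnd (r M) y (reverse py)
        ≡⟨ cong (λ z → walkEnd (r M) z (reverse py)) (sym (proj₂ (connected M F.zero y))) ⟩
      walkEnd (r M) (walkEnd (r M) F.zero py) (reverse py)
        ≡⟨ walkEnd-reverse (r M) (involution M) F.zero py ⟩
      F.zero
        ∎
    odd : parity (length (px ++ i ∷ reverse py)) ≡ 1ℙ
    odd = begin
      parity (length (px ++ i ∷ reverse py))
        ≡⟨ cong parity (length-++ px) ⟩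
      parity (length px ℕ.+ suc (length (reverse py)))
        ≡⟨ +-homo-+ (length px) _ ⟩
      distanceParity x ℙ.+ parity (suc (length (reverse py)))
        ≡⟨ cong (λ k → distanceParity x ℙ.+ parity (suc k)) (length-reverse py) ⟩
      distanceParity x ℙ.+ parity (1 ℕ.+ length py)
        ≡⟨ cong (distanceParity x ℙ.+_) (+-homo-+ 1 (length py)) ⟩
      distanceParity x ℙ.+ distanceParity y ⁻¹
        ≡⟨ cong (λ p → distanceParity x ℙ.+ p ⁻¹) same ⟩
      distanceParity x ℙ.+ distanceParity x ⁻¹
        ≡⟨ p+p⁻¹≡1ℙ (distanceParity x) ⟩
      1ℙ
        ∎

  nonBipartite⇒oddClosedWalk : ¬ Bipartite M →
    ∃ λ cs → ClosedWalk (r M) F.zero cs × parity (length cs) ≡ 1ℙ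
  nonBipartite⇒oddClosedWalk nonBipartite
    with any? (λ x → any? (λ i → distanceParity (r M i x) ℙ.≟ distanceParity x))
  ... | yes (x , i , same) = monochromaticEdge⇒oddClosedWalk x i same
  ... | no noneSame = ⊥-elim (nonBipartite (toBool ∘ distanceParity , proper))
    where
    toBool : Parity → Bool
    toBool 0ℙ = false
    toBool 1ℙ = true
    toBool-injective : ∀ {p p′} → toBool p ≡ toBool p′ → p ≡ p′
    toBool-injective {0ℙ} {0ℙ} _ = refl
    toBool-injective {1ℙ} {1ℙ} _ = refl
    proper : ∀ i x → toBool (distanceParity (r M i x)) ≢ toBool (distanceParity x)
    proper i x eq = noneSame (x , i , toBool-injective eq)

nonOrientable⇒oddClosedWalk : ∀ {n} (M : Maniplex3 n) → NonOrientable M →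
  ∃ λ x → ∃ λ cs → ClosedWalk (r M) x cs × parity (length cs) ≡ 1ℙ
nonOrientable⇒oddClosedWalk {zero}  M nonOrientable = ⊥-elim (nonOrientable ((λ ()) , λ _ ()))
nonOrientable⇒oddClosedWalk {suc n} M nonOrientable = F.zero , nonBipartite⇒oddClosedWalk M nonOrientable

oddComponentCycle⇒closedWalk : ∀ {n} (M : Maniplex3 n) {i j x} k → ∣ θ i ∣ ℕ.+ ∣ θ j ∣ ≡ 1 →
  ComponentCycleLength M i j x (2 * k) → Odd k →
  ∃ λ cs → ClosedWalk (r M) x cs × parity (length cs) ≡ 0ℙ × parity (unsignedWeight cs) ≡ 1ℙ
oddComponentCycle⇒closedWalk M {i} {j} {x} k θij≡1 (m , (_ , returns , _) , 2k≡2m) odd-k =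
  alternating m i j ,
  trans (walkEnd-alternating (r M) m i j x) returns ,
  parity-length-alternating m i j ,
  (begin
    parity (unsignedWeight (alternating m i j)) ≡⟨ cong parity (unsignedWeight-alternating m i j) ⟩
    parity (m * (∣ θ i ∣ ℕ.+ ∣ θ j ∣))          ≡⟨ cong (λ l → parity (m * l)) θij≡1 ⟩
    parity (m * 1)                              ≡⟨ cong parity (*-identityʳ m) ⟩
    parity m                                    ≡⟨ cong parity (*-cancelˡ-≡ m k 2 (sym 2k≡2m)) ⟩
    parity k                                    ≡⟨ odd⇒parity≡1ℙ k odd-k ⟩
    1ℙ                                          ∎)

evenClosedWalkOfOddUnsignedWeight : ∀ {n} (M : Maniplex3 n) {p q} → HasType M p q → Odd p ⊎ Odd q →
  ∀ x → ∃ λ cs → ClosedWalk (r M) x cs × parity (length cs) ≡ 0ℙ × parity (unsignedWeight cs) ≡ 1ℙ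
evenClosedWalkOfOddUnsignedWeight M {p} {q} type (inj₁ odd-p) x =
  oddComponentCycle⇒closedWalk M p refl (proj₁ (type x)) odd-p
evenClosedWalkOfOddUnsignedWeight M {p} {q} type (inj₂ odd-q) x =
  oddComponentCycle⇒closedWalk M q refl (proj₂ (type x)) odd-q

corollary6p2 : ∀ {n} (M : Maniplex3 n) (p q : ℕ) →
    RegularMap M → NonOrientable M → HasType M p q → Odd p ⊎ Odd q →
    ∃ λ (x : Fin n) → ∃ λ (cs : List Colour) →
      walkEnd (r M) x cs ≡ x × Odd (length cs) × EvenWeight cs
corollary6p2 M p q _ nonOrientable type oddType
  with nonOrientable⇒oddClosedWalk M nonOrientable
... | x , W , W-closed , W-odd with parity (unsignedWeight W) in W-weight
...   | 0ℙ = x , W , W-closed , parity≡1ℙ⇒odd (length W) W-odd , even-unsignedWeight⇒EvenWeight W W-weight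
...   | 1ℙ with evenClosedWalkOfOddUnsignedWeight M {p} {q} type oddType x
...     | C , C-closed , C-even , C-weight =
  x , W ++ C , closed-++ (r M) {xs = W} {ys = C} W-closed C-closed ,
  parity≡1ℙ⇒odd (length (W ++ C))
    (trans (parity-++ length (λ xs ys → length-++ xs) W C) (cong₂ ℙ._+_ W-odd C-even)) ,
  even-unsignedWeight⇒EvenWeight (W ++ C)
    (trans (parity-++ unsignedWeight unsignedWeight-++ W C) (cong₂ ℙ._+_ W-weight C-weight))
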